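{- Let $M=(m_{ij})$ be a binary matrix with $k$ rows, let $M'$ be a Tucker reduction of $M$, let $z$ be the label of any column of $M'$ consisting entirely of zeros, and let $a'=m_{1z}m_{2z}\dots m_{kz}$. Suppose there are a row map $\rho'$ and a column map $\sigma'$ of $M'$ such that $M'_{\rho',\sigma'}$ is a Tucker matrix, and let $k'$ be the number of rows of $M_{\rho',\sigma'}$. Then $M_{\rho,\sigma}$ equals $a\odot M_I(k')^*$ or $a\odot M_V^*$ for some binary sequence $a$ of length $k'$, with $\rho=\rho'$ and some column map $\sigma$ of $M$. More precisely: (i) if $M'_{\rho',\sigma'}=M_I(k')$, then $M_{\rho,\sigma}=a\odot M_I(k')^*$ where $a=a'_\rho$, $\rho=\rho'$, $\sigma=\langle\sigma'(1),\dots,\sigma'(k'),z\rangle$; (ii) if $M'_{\rho',\sigma'}=M_{II}(k')$, then $M_{\rho,\sigma}=a\odot M_I(k')^*$ where $a=a'_\rho+00\dots011$, $\rho=\rho'$, $\sigma=\langle\sigma'(1),\dots,\sigma'(k'-1),z,\sigma'(k')\rangle$; (iii) if $M'_{\rho',\sigma'}=M_{III}(k')$, then $M_{\rho,\sigma}=a\odot M_I(k')^*$ where $a=a'_\rho+00\dots01$, $\rho=\rho'$, $\sigma=\langle\sigma'(1),\dots,\sigma'(k'+1)\rangle$; (iv) if $M'_{\rho',\sigma'}=M_{IV}$, then $M_{\rho,\sigma}=a\odot M_V^*$ where $a=a'_\rho+0100$, $\rho=\rho'$, $\sigma=\langle\sigma'(2),\sigma'(1),\sigma'(5),\sigma'(6),\sigma'(4),\sigma'(3)\rangle$;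 (v) if $M'_{\rho',\sigma'}=M_V$, then $M_{\rho,\sigma}=a\odot M_V^*$ where $a=a'_\rho$, $\rho=\rho'$, $\sigma=\langle\sigma'(1),\dots,\sigma'(5),z\rangle$.
   Context: All matrices are binary; rows and columns of a $k\times\ell$ matrix are labeled $1..k$ and $1..\ell$. A Tucker reduction of $M$ is any matrix $M'$ obtained from $M$ by complementing some of its rows (exchanging $0,1$ in them) so that some column of $M'$ consists entirely of zeros. A row map of a $k\times \ell$ matrix $M$ is an injective function $\rho:[k']\to[k]$, a column map an injective $\sigma:[\ell']\to[\ell]$; $M_{\rho,\sigma}$ is the $k'\times\ell'$ matrix whose $(i,j)$ entry is the $(\rho(i),\sigma(j))$ entry of $M$. For distinct positive integers $n_1,\dots,n_s$, $\langle n_1,\dots,n_s\rangle$ is the function on $[s]$ sending $i$ to $n_i$. For a sequence $a=a_1\dots a_k$ and injective $\phi:[k']\to[k]$, $a_\phi=a_{\phi(1)}\dots a_{\phi(k')}$. For binary sequences of equal length, $a+b$ is the entrywise sum modulo $2$. $a\odot M$ complements each row $i$ with $a_i=1$; $M^*$ appends a last all-zero column. Tucker matrices: for $k\geq3$, $M_I(k)$ ($k\times k$): row $i<k$ has ones exactly in columns $i,i+1$, row $k$ in columns $1,k$. For $k\geq 4$, $M_{II}(k)$ ($k\times k$): row $i\leq k-2$ has ones exactly in columns $i,i+1$; row $k-1$ has ones exactly in columns $1,\dots,k-2$ and $k$; row $k$ has ones exactly in columns $2,\dots,k$. For $k\geq3$, $M_{III}(k)$ ($k\times(k+1)$): row $i\leq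 k-1$ has ones exactly in columns $i,i+1$; row $k$ has ones exactly in columns $2,\dots,k-1$ and $k+1$. $M_{IV}$ is $4\times6$ with rows $(1,1,0,0,0,0),(0,0,1,1,0,0),(0,0,0,0,1,1),(0,1,0,1,0,1)$; $M_V$ is $4\times5$ with rows $(1,1,0,0,0),(1,1,1,1,0),(0,0,1,1,0),(1,0,0,1,1)$. A Tucker matrix is any of $M_I(k)$ ($k\ge3$), $M_{II}(k)$ ($k\geq4$), $M_{III}(k)$ ($k\ge3$), $M_{IV}$, $M_V$. -}

module Defs where

open import Data.Bool using (Bool; true; false; _∧_; _∨_; _xor_; if_then_else_)
open import Data.Nat using (ℕ; zero; suc; _∸_; _≡ᵇ_; _≤ᵇ_; _<ᵇ_; _+_)
open import Data.Fin using (Fin; zero; suc; toℕ)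
open import Data.Vec using (Vec; []; _∷_; lookup)
open import Function using (_∘_)
open import Relation.Binary.PropositionalEquality using (_≡_)

-- A binary k × ℓ matrix: entry (i , j) with 0-based Fin indices
-- (row label i+1, column label j+1 in the paper's 1-based convention).
Mat : ℕ → ℕ → Set
Mat k ℓ = Fin k → Fin ℓ → Bool

Seq : ℕ → Set
Seq k = Fin k → Bool

_⊙_ : ∀ {k ℓ} → Seq k → Mat k ℓ → Mat k ℓ
(a ⊙ M) i j = a i xor M i j

_⊕_ : ∀ {k} → Seq k → Seq k → Seq k
(a ⊕ b) i = a i xor b i

_∘ₛ_ : ∀ {k k'} → Seq k → (Fin k' → Fin k) → Seq k'
a ∘ₛ φ = a ∘ φ

col : ∀ {k ℓ} → Mat k ℓ → Fin ℓ → Seq k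
col M z i = M i z

sub : ∀ {k ℓ k' ℓ'} → Mat k ℓ → (Fin k' → Fin k) → (Fin ℓ' → Fin ℓ) → Mat k' ℓ'
sub M ρ σ i j = M (ρ i) (σ j)

_≐_ : ∀ {k ℓ} → Mat k ℓ → Mat k ℓ → Set
A ≐ B = ∀ i j → A i j ≡ B i j

appendZero : ∀ {ℓ} → (Fin ℓ → Bool) → Fin (suc ℓ) → Bool
appendZero {zero}  r zero    = false
appendZero {suc ℓ} r zero    = r zero
appendZero {suc ℓ} r (suc j) = appendZero (r ∘ suc) j

_* : ∀ {k ℓ} → Mat k ℓ → Mat k (suc ℓ)
(M *) i = appendZero (M i)

-- value of a finite sequence at the 1-based label r (default d when out of range)
at : ∀ {n} {A : Set} → (Fin n → A) → A → ℕ → A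
at {zero}  f d r             = d
at {suc n} f d zero          = d
at {suc n} f d (suc zero)    = f zero
at {suc n} f d (suc (suc r)) = at (f ∘ suc) d (suc r)

byLabel : ∀ {n} {A : Set} → (ℕ → A) → Fin n → A
byLabel f j = f (suc (toℕ j))

byLabels : ∀ {k ℓ} → (ℕ → ℕ → Bool) → Mat k ℓ
byLabels f i j = f (suc (toℕ i)) (suc (toℕ j))

-- the sequence 00…0 1…1 of length n ending with m ones
lastOnes : ∀ {n} → ℕ → Seq n
lastOnes {n} m i = n ≤ᵇ (toℕ i + m)

-- Tucker matrices (entries on 1-based labels r = row, c = column)
M-I : (k : ℕ) → Mat k k
M-I k = byLabels λ r c →
  ((r <ᵇ k) ∧ ((c ≡ᵇ r) ∨ (c ≡ᵇ suc r))) ∨ ((r ≡ᵇ k) ∧ ((c ≡ᵇ 1) ∨ (c ≡ᵇ k)))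

M-II : (k : ℕ) → Mat k k
M-II k = byLabels λ r c →
  ((r ≤ᵇ k ∸ 2) ∧ ((c ≡ᵇ r) ∨ (c ≡ᵇ suc r)))
  ∨ ((r ≡ᵇ k ∸ 1) ∧ (((1 ≤ᵇ c) ∧ (c ≤ᵇ k ∸ 2)) ∨ (c ≡ᵇ k)))
  ∨ ((r ≡ᵇ k) ∧ ((2 ≤ᵇ c) ∧ (c ≤ᵇ k)))

M-III : (k : ℕ) → Mat k (suc k)
M-III k = byLabels λ r c →
  ((r ≤ᵇ k ∸ 1) ∧ ((c ≡ᵇ r) ∨ (c ≡ᵇ suc r)))
  ∨ ((r ≡ᵇ k) ∧ (((2 ≤ᵇ c) ∧ (c ≤ᵇ k ∸ 1)) ∨ (c ≡ᵇ suc k)))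

private
  O I : Bool
  O = false
  I = true

M-IV : Mat 4 6
M-IV i j = lookup (lookup rows i) j
  where
  rows : Vec (Vec Bool 6) 4
  rows = (I ∷ I ∷ O ∷ O ∷ O ∷ O ∷ [])
       ∷ (O ∷ O ∷ I ∷ I ∷ O ∷ O ∷ [])
       ∷ (O ∷ O ∷ O ∷ O ∷ I ∷ I ∷ [])
       ∷ (O ∷ I ∷ O ∷ I ∷ O ∷ I ∷ [])
       ∷ []

M-V : Mat 4 5
M-V i j = lookup (lookup rows i) j
  where
  rows : Vec (Vec Bool 5) 4
  rows = (I ∷ I ∷ O ∷ O ∷ O ∷ [])
       ∷ (I ∷ I ∷ I ∷ I ∷ O ∷ [])
       ∷ (O ∷ O ∷ I ∷ I ∷ O ∷ [])
       ∷ (I ∷ O ∷ O ∷ I ∷ I ∷ [])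
       ∷ []

s0100 : Seq 4
s0100 = lookup (O ∷ I ∷ O ∷ O ∷ [])

⟨_⟩₆ : ∀ {A : Set} → Vec A 6 → Fin 6 → A
⟨ v ⟩₆ = lookup v

module Submission where

-- A Tucker reduction is M′ = c ⊙ M, and as column z of M′ is zero, c is column z of M. Hence every
-- submatrix of M is (col M z)_ρ ⊙ (the same submatrix of M′), and the theorem reduces to identities
-- between Tucker matrices: appending the zero column z to M_I(k) or M_V gives M_I(k)* or M_V*;
-- inserting it before the last column of M_II(k) gives 00…011 ⊙ M_I(k)*; M_III(k) = 00…01 ⊙ M_I(k)*;
-- and the columns 2,1,5,6,4,3 of M_IV form 0100 ⊙ M_V*. The new column maps stay injective because
-- no column of a Tucker matrix is zero, so σ′ never takes the value z.

open import Defs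
open import Data.Bool using (Bool; true; false; _∧_; _∨_; _xor_; not; if_then_else_)
open import Data.Bool.Properties using (∨-identityʳ; ∨-zeroʳ; xor-assoc; xor-same; xor-identityʳ)
open import Data.Empty using (⊥-elim)
open import Data.Fin using (Fin; zero; suc; toℕ; fromℕ; inject₁; #_)
open import Data.Fin.Properties
  using (toℕ<n; toℕ-fromℕ; toℕ-inject₁; fromℕ≢inject₁; inject₁-injective)
open import Data.Fin.Relation.Unary.Top using (View; view; ‵fromℕ; ‵inj₁; ‵inject₁)
open import Data.Nat using (ℕ; zero; suc; _+_; _∸_; _≤_; _<_; _≡ᵇ_; _≤ᵇ_; _<ᵇ_; s≤s; s≤s⁻¹)
open import Data.Nat.Properties
  using ( _≟_; _≤?_; _<?_; <⇒≢; >⇒≢; <⇒≱; ≤⇒≯; <⇒≤; ≤-refl; n≤1+n; n<1+n; m<n⇒m<1+n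
        ; m≤n⇒m<n∨m≡n; +-comm)
open import Data.Product using (_×_; _,_; ∃-syntax)
open import Data.Sum using (_⊎_; inj₁; inj₂)
open import Data.Vec using (_∷_; []; lookup; tabulate)
open import Data.Vec.Functional using (init; last)
open import Data.Vec.Properties using (lookup∘tabulate)
open import Function using (_∘_)
open import Function.Definitions using (Injective)
open import Function.Consequences.Propositional using (inverseʳ⇒injective; strictlyInverseʳ⇒inverseʳ)
open import Relation.Nullary.Decidable using (dec-true; dec-false)
open import Relation.Binary.PropositionalEquality
  using (_≡_; _≢_; _≗_; refl; sym; trans; cong; cong₂; module ≡-Reasoning)

open ≡-Reasoning

private variable
  A B : Set
  m n r c K J : ℕ

-- `does (m ≟ n)` unfolds to `m ≡ᵇ n`, and likewise for `_≤?_` and `_<?_`.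

≡ᵇ-true : m ≡ n → (m ≡ᵇ n) ≡ true
≡ᵇ-true {m} {n} = dec-true (m ≟ n)

≡ᵇ-false : m ≢ n → (m ≡ᵇ n) ≡ false
≡ᵇ-false {m} {n} = dec-false (m ≟ n)

≤ᵇ-true : m ≤ n → (m ≤ᵇ n) ≡ true
≤ᵇ-true {m} {n} = dec-true (m ≤? n)

≤ᵇ-false : n < m → (m ≤ᵇ n) ≡ false
≤ᵇ-false {n} {m} n<m = dec-false (m ≤? n) (<⇒≱ n<m)

<ᵇ-true : m < n → (m <ᵇ n) ≡ true
<ᵇ-true {m} {n} = dec-true (m <? n)

<ᵇ-false : n ≤ m → (m <ᵇ n) ≡ false
<ᵇ-false {n} {m} n≤m = dec-false (m <? n) (≤⇒≯ n≤m)

<ᵇ≡not≡ᵇ : m ≤ n → (m <ᵇ n) ≡ not (m ≡ᵇ n)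
<ᵇ≡not≡ᵇ {m} m≤n with m≤n⇒m<n∨m≡n m≤n
... | inj₁ m<n rewrite <ᵇ-true m<n | ≡ᵇ-false (<⇒≢ m<n) = refl
... | inj₂ refl rewrite <ᵇ-false (≤-refl {m}) | ≡ᵇ-true (refl {x = m}) = refl

xor-cancelˡ : ∀ x y → x xor (x xor y) ≡ y
xor-cancelˡ x y = trans (sym (xor-assoc x x y)) (cong (_xor y) (xor-same x))

xor≡false⇒≡ : ∀ {x y} → x xor y ≡ false → y ≡ x
xor≡false⇒≡ {false} {false} _ = refl
xor≡false⇒≡ {true}  {true}  _ = refl

-- Appending to finite sequences

_∷ʳ_ : (Fin n → A) → A → Fin (suc n) → A
_∷ʳ_ {zero}  f x zero    = x
_∷ʳ_ {suc n} f x zero    = f zero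
_∷ʳ_ {suc n} f x (suc j) = ((f ∘ suc) ∷ʳ x) j

∷ʳ-inject₁ : ∀ (f : Fin n → A) x j → (f ∷ʳ x) (inject₁ j) ≡ f j
∷ʳ-inject₁ f x zero    = refl
∷ʳ-inject₁ f x (suc j) = ∷ʳ-inject₁ (f ∘ suc) x j

∷ʳ-fromℕ : ∀ (f : Fin n → A) x → (f ∷ʳ x) (fromℕ n) ≡ x
∷ʳ-fromℕ {zero}  f x = refl
∷ʳ-fromℕ {suc n} f x = ∷ʳ-fromℕ (f ∘ suc) x

∘-∷ʳ : ∀ (g : A → B) (f : Fin n → A) x → g ∘ (f ∷ʳ x) ≗ (g ∘ f) ∷ʳ g x
∘-∷ʳ {n = zero}  g f x zero    = refl
∘-∷ʳ {n = suc n} g f x zero    = refl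
∘-∷ʳ {n = suc n} g f x (suc j) = ∘-∷ʳ g (f ∘ suc) x j

∷ʳ-cong : ∀ {f g : Fin n → A} {x y} → f ≗ g → x ≡ y → f ∷ʳ x ≗ g ∷ʳ y
∷ʳ-cong {n = zero}  f≗g x≡y zero    = x≡y
∷ʳ-cong {n = suc n} f≗g x≡y zero    = f≗g zero
∷ʳ-cong {n = suc n} f≗g x≡y (suc j) = ∷ʳ-cong (f≗g ∘ suc) x≡y j

∷ʳ-injective : ∀ {f : Fin n → A} {x} → Injective _≡_ _≡_ f → (∀ j → f j ≢ x) →
               Injective _≡_ _≡_ (f ∷ʳ x)
∷ʳ-injective {f = f} {x} f-inj x∉f {j₁} {j₂} eq with view j₁ | view j₂
... | ‵fromℕ     | ‵fromℕ     = refl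
... | ‵fromℕ     | ‵inject₁ b =
  ⊥-elim (x∉f b (trans (sym (∷ʳ-inject₁ f x b)) (trans (sym eq) (∷ʳ-fromℕ f x))))
... | ‵inject₁ a | ‵fromℕ     =
  ⊥-elim (x∉f a (trans (sym (∷ʳ-inject₁ f x a)) (trans eq (∷ʳ-fromℕ f x))))
... | ‵inject₁ a | ‵inject₁ b =
  cong inject₁ (f-inj (trans (sym (∷ʳ-inject₁ f x a)) (trans eq (∷ʳ-inject₁ f x b))))

∷ʳ-before-last-injective : ∀ {σ : Fin (suc n) → A} {x} →
  Injective _≡_ _≡_ σ → (∀ j → σ j ≢ x) → Injective _≡_ _≡_ ((init σ ∷ʳ x) ∷ʳ last σ)
∷ʳ-before-last-injective {n = n} {σ = σ} {x} σ-inj x∉σ =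
  ∷ʳ-injective (∷ʳ-injective (λ eq → inject₁-injective (σ-inj eq)) (x∉σ ∘ inject₁)) last-new
  where
  last-new : ∀ j → (init σ ∷ʳ x) j ≢ last σ
  last-new j eq with view j
  ... | ‵fromℕ     = x∉σ (fromℕ n) (trans (sym eq) (∷ʳ-fromℕ (init σ) x))
  ... | ‵inject₁ a = fromℕ≢inject₁ (sym (σ-inj (trans (sym (∷ʳ-inject₁ (init σ) x a)) eq)))

injective-resp-≗ : ∀ {f g : A → B} → f ≗ g → Injective _≡_ _≡_ g → Injective _≡_ _≡_ f
injective-resp-≗ f≗g g-inj eq = g-inj (trans (sym (f≗g _)) (trans eq (f≗g _)))

≗-by-tabulate : ∀ {f g : Fin n → A} → tabulate f ≡ tabulate g → f ≗ g
≗-by-tabulate {f = f} {g} eq j = begin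
  f j                   ≡⟨ sym (lookup∘tabulate f j) ⟩
  lookup (tabulate f) j ≡⟨ cong (λ v → lookup v j) eq ⟩
  lookup (tabulate g) j ≡⟨ lookup∘tabulate g j ⟩
  g j                   ∎

toℕ-inject₁-fromℕ : ∀ n → toℕ (inject₁ (fromℕ n)) ≡ n
toℕ-inject₁-fromℕ n = trans (toℕ-inject₁ (fromℕ n)) (toℕ-fromℕ n)

toℕ-inject₁-inject₁ : ∀ (j : Fin n) → toℕ (inject₁ (inject₁ j)) ≡ toℕ j
toℕ-inject₁-inject₁ j = trans (toℕ-inject₁ (inject₁ j)) (toℕ-inject₁ j)

at-label : ∀ (f : Fin n → A) d j → toℕ j ≡ m → at f d (suc m) ≡ f j
at-label f d zero    refl = refl
at-label f d (suc j) refl = at-label (f ∘ suc) d j refl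

at-labels : ∀ {k ℓ} (f : ℕ → ℕ → Bool) (i : Fin k) (j : Fin ℓ) → toℕ i ≡ r → toℕ j ≡ c →
            byLabels f i j ≡ f (suc r) (suc c)
at-labels f i j refl refl = refl

byLabel-∷ʳ : ∀ (f : Fin n → A) d → byLabel (λ r → if r ≤ᵇ n then at f d r else d) ≗ f ∷ʳ d
byLabel-∷ʳ {n} f d j with view j
... | ‵fromℕ rewrite toℕ-fromℕ n | ≤ᵇ-false (n<1+n n) = sym (∷ʳ-fromℕ f d)
... | ‵inject₁ a rewrite toℕ-inject₁ a | ≤ᵇ-true (toℕ<n a) =
  trans (at-label f d a refl) (sym (∷ʳ-inject₁ f d a))

byLabel-∷ʳ-before-last : ∀ (f : Fin (suc n) → A) d →
  byLabel (λ r → if r ≤ᵇ n then at f d r else if r ≡ᵇ suc n then d else at f d (suc n))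
  ≗ (init f ∷ʳ d) ∷ʳ last f
byLabel-∷ʳ-before-last {n} f d j with view j
... | ‵fromℕ rewrite toℕ-fromℕ n | <ᵇ-false (n≤1+n n) | ≡ᵇ-false (>⇒≢ (n<1+n n)) =
  trans (at-label f d (fromℕ n) (toℕ-fromℕ n)) (sym (∷ʳ-fromℕ (init f ∷ʳ d) (last f)))
... | ‵inj₁ ‵fromℕ rewrite toℕ-inject₁-fromℕ n | <ᵇ-false (≤-refl {n}) | ≡ᵇ-true (refl {x = n}) =
  sym (trans (∷ʳ-inject₁ (init f ∷ʳ d) (last f) (fromℕ n)) (∷ʳ-fromℕ (init f) d))
... | ‵inj₁ (‵inject₁ a) rewrite toℕ-inject₁-inject₁ a | <ᵇ-true (toℕ<n a) =
  trans (at-label f d (inject₁ a) (toℕ-inject₁ a))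
        (sym (trans (∷ʳ-inject₁ (init f ∷ʳ d) (last f) (inject₁ a)) (∷ʳ-inject₁ (init f) d a)))

-- Submatrices

appendZero≗∷ʳ : ∀ (f : Fin n → Bool) → appendZero f ≗ f ∷ʳ false
appendZero≗∷ʳ {zero}  f zero    = refl
appendZero≗∷ʳ {suc n} f zero    = refl
appendZero≗∷ʳ {suc n} f (suc j) = appendZero≗∷ʳ (f ∘ suc) j

appendZero-inject₁ : ∀ (f : Fin n → Bool) j → appendZero f (inject₁ j) ≡ f j
appendZero-inject₁ f j = trans (appendZero≗∷ʳ f (inject₁ j)) (∷ʳ-inject₁ f false j)

appendZero-fromℕ : ∀ (f : Fin n → Bool) → appendZero f (fromℕ n) ≡ false
appendZero-fromℕ f = trans (appendZero≗∷ʳ f (fromℕ _)) (∷ʳ-fromℕ f false)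

⊙-⊙ : ∀ {k ℓ} (a b : Seq k) (T : Mat k ℓ) → (a ⊙ (b ⊙ T)) ≐ ((a ⊕ b) ⊙ T)
⊙-⊙ a b T i j = sym (xor-assoc (a i) (b i) (T i j))

≐-by-tabulate : ∀ {k ℓ} {T U : Mat k ℓ} → tabulate (tabulate ∘ T) ≡ tabulate (tabulate ∘ U) → T ≐ U
≐-by-tabulate eq i = ≗-by-tabulate (≗-by-tabulate eq i)

NoZeroColumn : ∀ {k ℓ} → Mat k ℓ → Set
NoZeroColumn T = ∀ j → ∃[ i ] T i j ≡ true

module _ {k ℓ} (N : Mat k ℓ) {k' : ℕ} {ρ : Fin k' → Fin k} where

  sub-resp-≗ : ∀ {ℓ'} {σ τ : Fin ℓ' → Fin ℓ} {T : Mat k' ℓ'} →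
               σ ≗ τ → sub N ρ τ ≐ T → sub N ρ σ ≐ T
  sub-resp-≗ σ≗τ N≐T i j = trans (cong (N (ρ i)) (σ≗τ j)) (N≐T i j)

  sub-∷ʳ : ∀ {n} {σ : Fin n → Fin ℓ} {T : Mat k' n} {x : Fin ℓ} {y : Seq k'} →
           sub N ρ σ ≐ T → (∀ i → N (ρ i) x ≡ y i) → sub N ρ (σ ∷ʳ x) ≐ (λ i → T i ∷ʳ y i)
  sub-∷ʳ {σ = σ} {x = x} N≐T Nx≡y i j =
    trans (∘-∷ʳ (N (ρ i)) σ x j) (∷ʳ-cong (N≐T i) (Nx≡y i) j)

  module _ {z : Fin ℓ} (z-zero : ∀ i → N i z ≡ false) where

    column-map-avoids-zero-column : ∀ {ℓ'} {σ : Fin ℓ' → Fin ℓ} {T : Mat k' ℓ'} →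
      sub N ρ σ ≐ T → NoZeroColumn T → ∀ j → σ j ≢ z
    column-map-avoids-zero-column {σ = σ} {T} N≐T ones j σj≡z with ones j
    ... | i , Tij≡true with begin
      true          ≡⟨ sym Tij≡true ⟩
      T i j         ≡⟨ sym (N≐T i j) ⟩
      N (ρ i) (σ j) ≡⟨ cong (N (ρ i)) σj≡z ⟩
      N (ρ i) z     ≡⟨ z-zero (ρ i) ⟩
      false         ∎
    ...   | ()

    sub-∷ʳ-zero-column : ∀ {ℓ'} {σ : Fin ℓ' → Fin ℓ} {T : Mat k' ℓ'} →
      sub N ρ σ ≐ T → sub N ρ (σ ∷ʳ z) ≐ (T *)
    sub-∷ʳ-zero-column {T = T} N≐T i j =
      trans (sub-∷ʳ {y = λ _ → false} N≐T (z-zero ∘ ρ) i j) (sym (appendZero≗∷ʳ (T i) j))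

    sub-zero-column-before-last : ∀ {n} {σ : Fin (suc n) → Fin ℓ} {T : Mat k' (suc n)} →
      sub N ρ σ ≐ T →
      sub N ρ ((init σ ∷ʳ z) ∷ʳ last σ) ≐ (λ i → (init (T i) ∷ʳ false) ∷ʳ last (T i))
    sub-zero-column-before-last {n} {T = T} N≐T =
      sub-∷ʳ (sub-∷ʳ {T = init ∘ T} {y = λ _ → false} (λ i j → N≐T i (inject₁ j)) (z-zero ∘ ρ))
             (λ i → N≐T i (fromℕ n))

-- Tucker matrices

-- The bodies of M-I, M-II and M-III, so that for instance M-I k i j reduces to
-- M-I-at k (suc (toℕ i)) (suc (toℕ j)). Lemmas stated at labels suc r, suc c take the 0-based
-- indices r = toℕ i, c = toℕ j.

M-I-at : ℕ → ℕ → ℕ → Bool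
M-I-at k r c = ((r <ᵇ k) ∧ ((c ≡ᵇ r) ∨ (c ≡ᵇ suc r))) ∨ ((r ≡ᵇ k) ∧ ((c ≡ᵇ 1) ∨ (c ≡ᵇ k)))

M-II-at : ℕ → ℕ → ℕ → Bool
M-II-at k r c = ((r ≤ᵇ k ∸ 2) ∧ ((c ≡ᵇ r) ∨ (c ≡ᵇ suc r)))
  ∨ ((r ≡ᵇ k ∸ 1) ∧ (((1 ≤ᵇ c) ∧ (c ≤ᵇ k ∸ 2)) ∨ (c ≡ᵇ k)))
  ∨ ((r ≡ᵇ k) ∧ ((2 ≤ᵇ c) ∧ (c ≤ᵇ k)))

M-III-at : ℕ → ℕ → ℕ → Bool
M-III-at k r c = ((r ≤ᵇ k ∸ 1) ∧ ((c ≡ᵇ r) ∨ (c ≡ᵇ suc r)))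
  ∨ ((r ≡ᵇ k) ∧ (((2 ≤ᵇ c) ∧ (c ≤ᵇ k ∸ 1)) ∨ (c ≡ᵇ suc k)))

M-I-at-row : ∀ {k} c → r < k → M-I-at k r c ≡ (c ≡ᵇ r) ∨ (c ≡ᵇ suc r)
M-I-at-row c r<k rewrite <ᵇ-true r<k | ≡ᵇ-false (<⇒≢ r<k) = ∨-identityʳ _

M-I-at-last-row : ∀ k c → M-I-at k k c ≡ (c ≡ᵇ 1) ∨ (c ≡ᵇ k)
M-I-at-last-row k c rewrite <ᵇ-false (≤-refl {k}) | ≡ᵇ-true (refl {x = k}) = refl

M-II-at-row : ∀ c → r ≤ J → M-II-at (suc (suc J)) r c ≡ (c ≡ᵇ r) ∨ (c ≡ᵇ suc r)
M-II-at-row c r≤J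
  rewrite ≤ᵇ-true r≤J | ≡ᵇ-false (<⇒≢ (s≤s r≤J)) | ≡ᵇ-false (<⇒≢ (s≤s (<⇒≤ (s≤s r≤J)))) =
  ∨-identityʳ _

M-II-at-second-last-row : ∀ J c →
  M-II-at (suc (suc J)) (suc J) c ≡ ((1 ≤ᵇ c) ∧ (c ≤ᵇ J)) ∨ (c ≡ᵇ suc (suc J))
M-II-at-second-last-row J c
  rewrite ≤ᵇ-false (n<1+n J) | ≡ᵇ-true (refl {x = J}) | ≡ᵇ-false (<⇒≢ (n<1+n J)) = ∨-identityʳ _

M-II-at-last-row : ∀ J c → M-II-at (suc (suc J)) (suc (suc J)) c ≡ (2 ≤ᵇ c) ∧ (c ≤ᵇ suc (suc J))
M-II-at-last-row J c
  rewrite ≤ᵇ-false (<⇒≤ (s≤s (n<1+n J))) | ≡ᵇ-false (>⇒≢ (n<1+n J)) | ≡ᵇ-true (refl {x = J}) =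
  refl

M-III-at-row : ∀ c → r < suc K → M-III-at (suc K) r c ≡ (c ≡ᵇ r) ∨ (c ≡ᵇ suc r)
M-III-at-row c r<k rewrite ≤ᵇ-true (s≤s⁻¹ r<k) | ≡ᵇ-false (<⇒≢ r<k) = ∨-identityʳ _

M-III-at-last-row : ∀ K c → M-III-at (suc K) (suc K) c ≡ ((2 ≤ᵇ c) ∧ (c ≤ᵇ K)) ∨ (c ≡ᵇ suc (suc K))
M-III-at-last-row K c rewrite ≤ᵇ-false (n<1+n K) | ≡ᵇ-true (refl {x = K}) = refl

m<2+n⇒m<n⊎m≡n⊎m≡1+n : r < suc (suc J) → r < J ⊎ r ≡ J ⊎ r ≡ suc J
m<2+n⇒m<n⊎m≡n⊎m≡1+n r<2+J with m≤n⇒m<n∨m≡n (s≤s⁻¹ r<2+J)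
... | inj₂ r≡1+J = inj₂ (inj₂ r≡1+J)
... | inj₁ r<1+J with m≤n⇒m<n∨m≡n (s≤s⁻¹ r<1+J)
...   | inj₁ r<J = inj₁ r<J
...   | inj₂ r≡J = inj₂ (inj₁ r≡J)

M-I-at-diagonal : ∀ {k} → r < k → M-I-at k (suc r) (suc r) ≡ true
M-I-at-diagonal {r} r<k with m≤n⇒m<n∨m≡n r<k
... | inj₁ 1+r<k rewrite M-I-at-row (suc r) 1+r<k | ≡ᵇ-true (refl {x = r}) = refl
... | inj₂ refl rewrite M-I-at-last-row (suc r) (suc r) | ≡ᵇ-true (refl {x = r}) = ∨-zeroʳ _

M-I-at-last-column : r < suc (suc J) → M-I-at (suc (suc J)) (suc r) (suc (suc J)) ≡ (suc (suc J) ≤ᵇ r + 2)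
M-I-at-last-column {r} {J} r<k rewrite +-comm r 2 with m<2+n⇒m<n⊎m≡n⊎m≡1+n r<k
... | inj₁ r<J
  rewrite M-I-at-row (suc (suc J)) (s≤s (<⇒≤ (s≤s r<J))) | ≡ᵇ-false (>⇒≢ (s≤s (<⇒≤ (s≤s r<J))))
        | ≡ᵇ-false (>⇒≢ (s≤s r<J)) | ≤ᵇ-false (s≤s (s≤s r<J)) = refl
... | inj₂ (inj₁ refl)
  rewrite M-I-at-row (suc (suc r)) (n<1+n (suc r)) | ≡ᵇ-false (>⇒≢ (n<1+n r)) | ≡ᵇ-true (refl {x = r})
        | ≤ᵇ-true (≤-refl {suc (suc r)}) = refl
... | inj₂ (inj₂ refl)
  rewrite M-I-at-last-row (suc (suc J)) (suc (suc J)) | ≡ᵇ-true (refl {x = J})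
        | <ᵇ-true (m<n⇒m<1+n (n<1+n J)) = refl

M-II-at-last-column : r < suc (suc J) → M-II-at (suc (suc J)) (suc r) (suc (suc J)) ≡ (suc (suc J) ≤ᵇ r + 2)
M-II-at-last-column {r} {J} r<k rewrite +-comm r 2 with m<2+n⇒m<n⊎m≡n⊎m≡1+n r<k
... | inj₁ r<J
  rewrite M-II-at-row (suc (suc J)) r<J | ≡ᵇ-false (>⇒≢ (s≤s (<⇒≤ (s≤s r<J))))
        | ≡ᵇ-false (>⇒≢ (s≤s r<J)) | ≤ᵇ-false (s≤s (s≤s r<J)) = refl
... | inj₂ (inj₁ refl)
  rewrite M-II-at-second-last-row r (suc (suc r)) | ≡ᵇ-true (refl {x = r}) | ≤ᵇ-true (≤-refl {suc (suc r)}) =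
  ∨-zeroʳ _
... | inj₂ (inj₂ refl)
  rewrite M-II-at-last-row J (suc (suc J)) | <ᵇ-true (n<1+n J) | <ᵇ-true (m<n⇒m<1+n (n<1+n J)) = refl

M-II-at-first-columns : r < suc (suc J) → c ≤ J →
  M-II-at (suc (suc J)) (suc r) (suc c) ≡ (suc (suc J) ≤ᵇ r + 2) xor M-I-at (suc (suc J)) (suc r) (suc c)
M-II-at-first-columns {r} {J} {c} r<k c≤J rewrite +-comm r 2 with m<2+n⇒m<n⊎m≡n⊎m≡1+n r<k
... | inj₁ r<J
  rewrite M-II-at-row (suc c) r<J | M-I-at-row {k = suc (suc J)} (suc c) (s≤s (<⇒≤ (s≤s r<J)))
        | ≤ᵇ-false (s≤s (s≤s r<J)) = refl
... | inj₂ (inj₁ refl)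
  rewrite M-II-at-second-last-row r (suc c) | M-I-at-row {k = suc (suc r)} (suc c) (n<1+n (suc r))
        | ≤ᵇ-true (≤-refl {suc (suc r)}) | ≡ᵇ-false (<⇒≢ (s≤s c≤J))
        | ∨-identityʳ (c <ᵇ r) | ∨-identityʳ (c ≡ᵇ r) = <ᵇ≡not≡ᵇ c≤J
... | inj₂ (inj₂ refl)
  rewrite M-II-at-last-row J (suc c) | M-I-at-last-row (suc (suc J)) (suc c)
        | <ᵇ-true (m<n⇒m<1+n (n<1+n J)) | <ᵇ-true (s≤s (m<n⇒m<1+n (s≤s c≤J)))
        | ≡ᵇ-false (<⇒≢ (s≤s c≤J))
  with c
...   | zero  = refl
...   | suc _ = refl

M-III-at-first-columns : r < suc K → c < suc K →
  M-III-at (suc K) (suc r) (suc c) ≡ (suc K ≤ᵇ r + 1) xor M-I-at (suc K) (suc r) (suc c)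
M-III-at-first-columns {r} {K} {c} r<k c<k rewrite +-comm r 1 with m≤n⇒m<n∨m≡n r<k
... | inj₁ 1+r<k rewrite M-III-at-row (suc c) 1+r<k | M-I-at-row (suc c) 1+r<k | ≤ᵇ-false 1+r<k = refl
... | inj₂ refl
  rewrite M-III-at-last-row r (suc c) | M-I-at-last-row (suc r) (suc c) | ≤ᵇ-true (≤-refl {suc r})
        | ≡ᵇ-false (<⇒≢ c<k)
  with c
...   | zero  = refl
...   | suc d rewrite ∨-identityʳ (suc d <ᵇ r) = <ᵇ≡not≡ᵇ (s≤s⁻¹ c<k)

M-III-at-last-column : r < suc K → M-III-at (suc K) (suc r) (suc (suc K)) ≡ (suc K ≤ᵇ r + 1)
M-III-at-last-column {r} {K} r<k rewrite +-comm r 1 with m≤n⇒m<n∨m≡n r<k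
... | inj₁ 1+r<k
  rewrite M-III-at-row (suc (suc K)) 1+r<k | ≡ᵇ-false (>⇒≢ (<⇒≤ 1+r<k)) | ≡ᵇ-false (>⇒≢ 1+r<k)
        | ≤ᵇ-false 1+r<k = refl
... | inj₂ refl
  rewrite M-III-at-last-row r (suc (suc r)) | ≡ᵇ-true (refl {x = r}) | ≤ᵇ-true (≤-refl {suc r}) = ∨-zeroʳ _

M-II-at-second-last-row-ones : c < J → M-II-at (suc (suc J)) (suc J) (suc c) ≡ true
M-II-at-second-last-row-ones {c} {J} c<J rewrite M-II-at-second-last-row J (suc c) | <ᵇ-true c<J = refl

M-II-at-second-last-row-last-column : ∀ J → M-II-at (suc (suc J)) (suc J) (suc (suc J)) ≡ true
M-II-at-second-last-row-last-column J
  rewrite M-II-at-second-last-row J (suc (suc J)) | ≡ᵇ-true (refl {x = J}) = ∨-zeroʳ _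

M-II-at-last-row-second-last-column : ∀ J → M-II-at (3 + J) (3 + J) (2 + J) ≡ true
M-II-at-last-row-second-last-column J
  rewrite M-II-at-last-row (suc J) (suc (suc J)) | <ᵇ-true (m<n⇒m<1+n (n<1+n (suc J))) = refl

M-I-no-zero-column : ∀ k → NoZeroColumn (M-I k)
M-I-no-zero-column k j = j , M-I-at-diagonal (toℕ<n j)

M-II-no-zero-column : ∀ J → NoZeroColumn (M-II (3 + J))
M-II-no-zero-column J j with view j
... | ‵fromℕ =
  second-last ,
  trans (at-labels (M-II-at (3 + J)) second-last j (toℕ-inject₁-fromℕ (suc J)) (toℕ-fromℕ (2 + J)))
        (M-II-at-second-last-row-last-column (suc J))
  where second-last = inject₁ (fromℕ (suc J))
... | ‵inj₁ ‵fromℕ =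
  fromℕ (2 + J) ,
  trans (at-labels (M-II-at (3 + J)) (fromℕ (2 + J)) j (toℕ-fromℕ (2 + J)) (toℕ-inject₁-fromℕ (suc J)))
        (M-II-at-last-row-second-last-column J)
... | ‵inj₁ (‵inject₁ a) =
  second-last ,
  trans (at-labels (M-II-at (3 + J)) second-last j (toℕ-inject₁-fromℕ (suc J)) (toℕ-inject₁-inject₁ a))
        (M-II-at-second-last-row-ones (toℕ<n a))
  where second-last = inject₁ (fromℕ (suc J))

M-V-no-zero-column : NoZeroColumn M-V
M-V-no-zero-column zero                         = # 0 , refl
M-V-no-zero-column (suc zero)                   = # 0 , refl
M-V-no-zero-column (suc (suc zero))             = # 1 , refl
M-V-no-zero-column (suc (suc (suc zero)))       = # 1 , refl
M-V-no-zero-column (suc (suc (suc (suc zero)))) = # 3 , refl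

M-I-last-column : ∀ J (i : Fin (2 + J)) → M-I (2 + J) i (fromℕ (suc J)) ≡ lastOnes 2 i
M-I-last-column J i rewrite toℕ-fromℕ J = M-I-at-last-column (toℕ<n i)

M-II-last-column : ∀ J (i : Fin (2 + J)) → M-II (2 + J) i (fromℕ (suc J)) ≡ lastOnes 2 i
M-II-last-column J i rewrite toℕ-fromℕ J = M-II-at-last-column (toℕ<n i)

M-II-first-columns : ∀ J (i : Fin (2 + J)) (j : Fin (suc J)) →
  M-II (2 + J) i (inject₁ j) ≡ lastOnes 2 i xor M-I (2 + J) i (inject₁ j)
M-II-first-columns J i j rewrite toℕ-inject₁ j = M-II-at-first-columns (toℕ<n i) (s≤s⁻¹ (toℕ<n j))

M-II-with-zero-column : ∀ J (i : Fin (2 + J)) →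
  (init (M-II (2 + J) i) ∷ʳ false) ∷ʳ last (M-II (2 + J) i) ≗ (lastOnes 2 ⊙ (M-I (2 + J) *)) i
M-II-with-zero-column J i j = column (view j)
  where
  T I : Fin (2 + J) → Bool
  T = M-II (2 + J) i
  I = M-I (2 + J) i
  L : Bool
  L = lastOnes 2 i

  column : ∀ {j} → View j → ((init T ∷ʳ false) ∷ʳ last T) j ≡ L xor appendZero I j
  column ‵fromℕ = begin
    ((init T ∷ʳ false) ∷ʳ last T) (fromℕ (2 + J)) ≡⟨ ∷ʳ-fromℕ (init T ∷ʳ false) (last T) ⟩
    last T                                        ≡⟨ M-II-last-column J i ⟩
    L                                             ≡⟨ sym (xor-identityʳ L) ⟩
    L xor false                                   ≡⟨ cong (L xor_) (sym (appendZero-fromℕ I)) ⟩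
    L xor appendZero I (fromℕ (2 + J))            ∎
  column (‵inj₁ ‵fromℕ) = begin
    ((init T ∷ʳ false) ∷ʳ last T) (inject₁ (fromℕ (suc J)))
      ≡⟨ ∷ʳ-inject₁ (init T ∷ʳ false) (last T) (fromℕ (suc J)) ⟩
    (init T ∷ʳ false) (fromℕ (suc J))
      ≡⟨ ∷ʳ-fromℕ (init T) false ⟩
    false
      ≡⟨ sym (xor-same L) ⟩
    L xor L
      ≡⟨ cong (L xor_) (sym (M-I-last-column J i)) ⟩
    L xor I (fromℕ (suc J))
      ≡⟨ cong (L xor_) (sym (appendZero-inject₁ I (fromℕ (suc J)))) ⟩
    L xor appendZero I (inject₁ (fromℕ (suc J)))
      ∎
  column (‵inj₁ (‵inject₁ a)) = begin
    ((init T ∷ʳ false) ∷ʳ last T) (inject₁ (inject₁ a))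
      ≡⟨ ∷ʳ-inject₁ (init T ∷ʳ false) (last T) (inject₁ a) ⟩
    (init T ∷ʳ false) (inject₁ a)
      ≡⟨ ∷ʳ-inject₁ (init T) false a ⟩
    T (inject₁ a)
      ≡⟨ M-II-first-columns J i a ⟩
    L xor I (inject₁ a)
      ≡⟨ cong (L xor_) (sym (appendZero-inject₁ I (inject₁ a))) ⟩
    L xor appendZero I (inject₁ (inject₁ a))
      ∎

M-III≐lastOnes⊙M-I* : ∀ k → M-III k ≐ (lastOnes 1 ⊙ (M-I k *))
M-III≐lastOnes⊙M-I* (suc K) i j with view j
... | ‵fromℕ rewrite appendZero-fromℕ (M-I (suc K) i) | xor-identityʳ (lastOnes 1 i) | toℕ-fromℕ K =
  M-III-at-last-column (toℕ<n i)
... | ‵inject₁ a rewrite appendZero-inject₁ (M-I (suc K) i) a | toℕ-inject₁ a =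
  M-III-at-first-columns (toℕ<n i) (toℕ<n a)

π-IV π-IV⁻¹ : Fin 6 → Fin 6
π-IV   = ⟨ # 1 ∷ # 0 ∷ # 4 ∷ # 5 ∷ # 3 ∷ # 2 ∷ [] ⟩₆
π-IV⁻¹ = ⟨ # 1 ∷ # 0 ∷ # 5 ∷ # 4 ∷ # 2 ∷ # 3 ∷ [] ⟩₆

π-IV-injective : Injective _≡_ _≡_ π-IV
π-IV-injective =
  inverseʳ⇒injective π-IV (strictlyInverseʳ⇒inverseʳ {f⁻¹ = π-IV⁻¹} π-IV π-IV⁻¹∘π-IV)
  where
  π-IV⁻¹∘π-IV : ∀ j → π-IV⁻¹ (π-IV j) ≡ j
  π-IV⁻¹∘π-IV = ≗-by-tabulate refl

M-IV-permuted : (λ i j → M-IV i (π-IV j)) ≐ (s0100 ⊙ (M-V *))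
M-IV-permuted = ≐-by-tabulate refl

-- Undoing a Tucker reduction

module TuckerReduction {k ℓ} (M : Mat k ℓ) (c : Seq k) (z : Fin ℓ)
                       (z-zero : ∀ i → (c ⊙ M) i z ≡ false) where

  unreduce : ∀ {k' ℓ'} (ρ : Fin k' → Fin k) (σ : Fin ℓ' → Fin ℓ) {T : Mat k' ℓ'} →
             sub (c ⊙ M) ρ σ ≐ T → sub M ρ σ ≐ ((col M z ∘ₛ ρ) ⊙ T)
  unreduce ρ σ {T} H i j = begin
    M (ρ i) (σ j)                   ≡⟨ sym (xor-cancelˡ (c (ρ i)) (M (ρ i) (σ j))) ⟩
    c (ρ i) xor (c ⊙ M) (ρ i) (σ j) ≡⟨ cong₂ _xor_ (sym (xor≡false⇒≡ {c (ρ i)} (z-zero (ρ i))))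
                                                   (H i j) ⟩
    M (ρ i) z xor T i j             ∎

  unreduce-⊕ : ∀ {k' ℓ'} (ρ : Fin k' → Fin k) (σ : Fin ℓ' → Fin ℓ) {b : Seq k'} {T : Mat k' ℓ'} →
               sub (c ⊙ M) ρ σ ≐ (b ⊙ T) → sub M ρ σ ≐ (((col M z ∘ₛ ρ) ⊕ b) ⊙ T)
  unreduce-⊕ ρ σ {b} {T} H i j = trans (unreduce ρ σ H i j) (⊙-⊙ (col M z ∘ₛ ρ) b T i j)

  unreduce-∷ʳ : ∀ {k' n} {ρ : Fin k' → Fin k} {σ' : Fin n → Fin ℓ} {T : Mat k' n}
                  {σ : Fin (suc n) → Fin ℓ} →
    σ ≗ σ' ∷ʳ z → Injective _≡_ _≡_ σ' → sub (c ⊙ M) ρ σ' ≐ T → NoZeroColumn T →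
    Injective _≡_ _≡_ σ × (sub M ρ σ ≐ ((col M z ∘ₛ ρ) ⊙ (T *)))
  unreduce-∷ʳ {ρ = ρ} {σ'} σ≗ σ'-inj H ones =
    injective-resp-≗ σ≗ (∷ʳ-injective σ'-inj (column-map-avoids-zero-column (c ⊙ M) z-zero H ones)) ,
    sub-resp-≗ M σ≗ (unreduce ρ (σ' ∷ʳ z) (sub-∷ʳ-zero-column (c ⊙ M) z-zero H))

  unreduce-II : ∀ J {ρ : Fin (3 + J) → Fin k} {σ' : Fin (3 + J) → Fin ℓ} {σ : Fin (4 + J) → Fin ℓ} →
    σ ≗ (init σ' ∷ʳ z) ∷ʳ last σ' → Injective _≡_ _≡_ σ' → sub (c ⊙ M) ρ σ' ≐ M-II (3 + J) →
    Injective _≡_ _≡_ σ × (sub M ρ σ ≐ (((col M z ∘ₛ ρ) ⊕ lastOnes 2) ⊙ (M-I (3 + J) *)))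
  unreduce-II J {ρ} {σ'} σ≗ σ'-inj H =
    injective-resp-≗ σ≗
      (∷ʳ-before-last-injective σ'-inj
        (column-map-avoids-zero-column (c ⊙ M) z-zero H (M-II-no-zero-column J))) ,
    sub-resp-≗ M σ≗ (unreduce-⊕ ρ ((init σ' ∷ʳ z) ∷ʳ last σ') {lastOnes 2} {M-I (3 + J) *} reduced)
    where
    reduced : sub (c ⊙ M) ρ ((init σ' ∷ʳ z) ∷ʳ last σ') ≐ (lastOnes 2 ⊙ (M-I (3 + J) *))
    reduced i j =
      trans (sub-zero-column-before-last (c ⊙ M) z-zero H i j) (M-II-with-zero-column (suc J) i j)

  unreduce-∘ : ∀ {k' n ℓ'} {ρ : Fin k' → Fin k} {σ' : Fin n → Fin ℓ} {π : Fin ℓ' → Fin n}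
                 {σ : Fin ℓ' → Fin ℓ} {T : Mat k' n} {b : Seq k'} {U : Mat k' ℓ'} →
    σ ≗ σ' ∘ π → Injective _≡_ _≡_ π → Injective _≡_ _≡_ σ' →
    sub (c ⊙ M) ρ σ' ≐ T → (λ i j → T i (π j)) ≐ (b ⊙ U) →
    Injective _≡_ _≡_ σ × (sub M ρ σ ≐ (((col M z ∘ₛ ρ) ⊕ b) ⊙ U))
  unreduce-∘ {ρ = ρ} {σ'} {π} {b = b} {U = U} σ≗ π-inj σ'-inj H T∘π≐U =
    injective-resp-≗ σ≗ (λ eq → π-inj (σ'-inj eq)) ,
    sub-resp-≗ M σ≗ (unreduce-⊕ ρ (σ' ∘ π) {b} {U} (λ i j → trans (H i (π j)) (T∘π≐U i j)))

lemma10 : ∀ {k ℓ} (M : Mat k ℓ) (c : Seq k) (z : Fin ℓ)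
  → (∀ i → (c ⊙ M) i z ≡ false)
  -- (i)
  → (∀ k' (ρ' : Fin k' → Fin k) (σ' : Fin k' → Fin ℓ)
      → 3 ≤ k' → Injective _≡_ _≡_ ρ' → Injective _≡_ _≡_ σ'
      → sub (c ⊙ M) ρ' σ' ≐ M-I k'
      → let σ = byLabel (λ r → if r ≤ᵇ k' then at σ' z r else z)
            a = col M z ∘ₛ ρ'
        in Injective _≡_ _≡_ σ × (sub M ρ' σ ≐ (a ⊙ (M-I k' *))))
  -- (ii)
  × (∀ k' (ρ' : Fin k' → Fin k) (σ' : Fin k' → Fin ℓ)
      → 4 ≤ k' → Injective _≡_ _≡_ ρ' → Injective _≡_ _≡_ σ'
      → sub (c ⊙ M) ρ' σ' ≐ M-II k'
      → let σ = byLabel (λ r → if r ≤ᵇ k' ∸ 1 then at σ' z r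
                                else if r ≡ᵇ k' then z else at σ' z k')
            a = (col M z ∘ₛ ρ') ⊕ lastOnes 2
        in Injective _≡_ _≡_ σ × (sub M ρ' σ ≐ (a ⊙ (M-I k' *))))
  -- (iii)
  × (∀ k' (ρ' : Fin k' → Fin k) (σ' : Fin (suc k') → Fin ℓ)
      → 3 ≤ k' → Injective _≡_ _≡_ ρ' → Injective _≡_ _≡_ σ'
      → sub (c ⊙ M) ρ' σ' ≐ M-III k'
      → let σ = σ'
            a = (col M z ∘ₛ ρ') ⊕ lastOnes 1
        in Injective _≡_ _≡_ σ × (sub M ρ' σ ≐ (a ⊙ (M-I k' *))))
  -- (iv)
  × (∀ (ρ' : Fin 4 → Fin k) (σ' : Fin 6 → Fin ℓ)
      → Injective _≡_ _≡_ ρ' → Injective _≡_ _≡_ σ'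
      → sub (c ⊙ M) ρ' σ' ≐ M-IV
      → let σ = ⟨ σ' (# 1) ∷ σ' (# 0) ∷ σ' (# 4) ∷ σ' (# 5) ∷ σ' (# 3) ∷ σ' (# 2) ∷ [] ⟩₆
            a = (col M z ∘ₛ ρ') ⊕ s0100
        in Injective _≡_ _≡_ σ × (sub M ρ' σ ≐ (a ⊙ (M-V *))))
  -- (v)
  × (∀ (ρ' : Fin 4 → Fin k) (σ' : Fin 5 → Fin ℓ)
      → Injective _≡_ _≡_ ρ' → Injective _≡_ _≡_ σ'
      → sub (c ⊙ M) ρ' σ' ≐ M-V
      → let σ = ⟨ σ' (# 0) ∷ σ' (# 1) ∷ σ' (# 2) ∷ σ' (# 3) ∷ σ' (# 4) ∷ z ∷ [] ⟩₆
            a = col M z ∘ₛ ρ'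
        in Injective _≡_ _≡_ σ × (sub M ρ' σ ≐ (a ⊙ (M-V *))))
lemma10 M c z z-zero =
    (λ k' _ σ' _ _ σ'-inj H → unreduce-∷ʳ (byLabel-∷ʳ σ' z) σ'-inj H (M-I-no-zero-column k'))
  , (λ { (suc (suc (suc (suc J)))) _ σ' (s≤s (s≤s (s≤s (s≤s _)))) _ σ'-inj H →
           unreduce-II (suc J) (byLabel-∷ʳ-before-last σ' z) σ'-inj H })
  , (λ k' ρ' σ' _ _ σ'-inj H →
       σ'-inj , unreduce-⊕ ρ' σ' (λ i j → trans (H i j) (M-III≐lastOnes⊙M-I* k' i j)))
  , (λ _ _ _ σ'-inj H → unreduce-∘ (≗-by-tabulate refl) π-IV-injective σ'-inj H M-IV-permuted)
  , (λ _ _ _ σ'-inj H → unreduce-∷ʳ (≗-by-tabulate refl) σ'-inj H M-V-no-zero-column)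
  where open TuckerReduction M c z z-zero
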